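{- Let $q=3^h$, let $X^3-X+a$ be an irreducible polynomial over $\mathbb{F}_q$, let $\alpha$ be a root of it, so that $\mathbb{F}_{q^3}=\mathbb{F}_q(\alpha)$. Then an element $\beta=b_0+b_1\alpha+b_2\alpha^2\in\mathbb{F}_{q^3}$ (with $b_0,b_1,b_2\in\mathbb{F}_q$) lies in $T_0T_0$ if and only if $b_1^2-b_0b_2$ is a square in $\mathbb{F}_{q^3}$.
   Context: $\mathrm{Tr}=\mathrm{Tr}_{\mathbb{F}_{q^3}/\mathbb{F}_q}$. $T_0=\{x\in\mathbb{F}_{q^3}\mid\mathrm{Tr}(x)=0\}$ and $T_0T_0=\{xy\mid x,y\in T_0\}$. Here $0$ counts as a square. -}

module Defs where

open import Level using (Level; _⊔_)
open import Algebra.Bundles using (CommutativeRing)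
open import Data.Nat as ℕ using (ℕ; zero; suc; _^_; _≤_; _∸_)
open import Data.Fin using (Fin)
open import Data.List using (List; []; _∷_)
open import Data.Product using (Σ; ∃; _×_; _,_)
open import Relation.Nullary using (¬_)
open import Relation.Binary.PropositionalEquality as ≡ using ()
open import Function.Bundles using (Bijection)

record IsField {c ℓ : Level} (R : CommutativeRing c ℓ) : Set (c ⊔ ℓ) where
  open CommutativeRing R
  field
    one≉zero : ¬ (1# ≈ 0#)
    inverse  : ∀ x → ¬ (x ≈ 0#) → ∃ λ y → x * y ≈ 1#

HasCardinality : {c ℓ : Level} → CommutativeRing c ℓ → ℕ → Set (c ⊔ ℓ)
HasCardinality R n = Bijection (≡.setoid (Fin n)) (CommutativeRing.setoid R)

module Over {c ℓ : Level} (R : CommutativeRing c ℓ) where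
  open CommutativeRing R

  Char3 : Set ℓ
  Char3 = (1# + 1#) + 1# ≈ 0#

  -- Polynomials over R: coefficient lists, lowest degree first.
  Poly : Set c
  Poly = List Carrier

  coeff : Poly → ℕ → Carrier
  coeff []       _       = 0#
  coeff (x ∷ p)  zero    = x
  coeff (x ∷ p)  (suc n) = coeff p n

  sumUpTo : ℕ → (ℕ → Carrier) → Carrier
  sumUpTo zero    f = f 0
  sumUpTo (suc n) f = sumUpTo n f + f (suc n)

  mulCoeff : Poly → Poly → ℕ → Carrier
  mulCoeff f g n = sumUpTo n (λ i → coeff f i * coeff g (n ∸ i))

  _≈P_ : Poly → Poly → Set ℓ
  p ≈P q = ∀ n → coeff p n ≈ coeff q n

  PositiveDegree : Poly → Set ℓ
  PositiveDegree p = ∃ λ d → 1 ≤ d × ¬ (coeff p d ≈ 0#)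

  Irreducible : Poly → Set (c ⊔ ℓ)
  Irreducible p = PositiveDegree p ×
    ¬ (Σ Poly λ f → Σ Poly λ g → PositiveDegree f × PositiveDegree g ×
         (∀ n → coeff p n ≈ mulCoeff f g n))

  cubic : Carrier → Poly
  cubic a = a ∷ (- 1#) ∷ 0# ∷ 1# ∷ []

  -- F_{q^3} = F_q[X]/(X^3 - X + a) = F_q(α), elements b0 + b1 α + b2 α²
  -- represented by their coordinate triples (b0 , b1 , b2).
  module Ext (a : Carrier) where
    E : Set c
    E = Carrier × Carrier × Carrier

    _≈E_ : E → E → Set ℓ
    (x0 , x1 , x2) ≈E (y0 , y1 , y2) = (x0 ≈ y0) × (x1 ≈ y1) × (x2 ≈ y2)

    ι : Carrier → E
    ι x = (x , 0# , 0#)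

    elt : Carrier → Carrier → Carrier → E
    elt b0 b1 b2 = (b0 , b1 , b2)

    _+E_ : E → E → E
    (x0 , x1 , x2) +E (y0 , y1 , y2) = (x0 + y0 , x1 + y1 , x2 + y2)

    -- multiplication using α³ = α - a (and hence α⁴ = α² - a α)
    _*E_ : E → E → E
    (x0 , x1 , x2) *E (y0 , y1 , y2) =
      let c0 = x0 * y0
          c1 = x0 * y1 + x1 * y0
          c2 = (x0 * y2 + x1 * y1) + x2 * y0
          c3 = x1 * y2 + x2 * y1
          c4 = x2 * y2
      in (c0 - a * c3 , (c1 + c3) - a * c4 , c2 + c4)

    _^E_ : E → ℕ → E
    x ^E zero  = ι 1#
    x ^E suc n = x *E (x ^E n)

    Tr : ℕ → E → E
    Tr q x = (x +E (x ^E q)) +E (x ^E (q ^ 2))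

    T₀ : ℕ → E → Set ℓ
    T₀ q x = Tr q x ≈E ι 0#

    InT₀T₀ : ℕ → E → Set (c ⊔ ℓ)
    InT₀T₀ q β = Σ E λ x → Σ E λ y → T₀ q x × T₀ q y × ((x *E y) ≈E β)

    IsSquareE : E → Set (c ⊔ ℓ)
    IsSquareE β = Σ E λ y → (y *E y) ≈E β

-- Since α³ = α - a, the Frobenius x ↦ x³ of F_q(α) maps α to α - a, so iterating it,
-- x ↦ x^q is the substitution α ↦ α - σ for some σ ∈ F_q.  σ ≠ 0, for otherwise the
-- q + 1 elements F_q ∪ {α} would all be roots of X^q - X.  Adding the three conjugates
-- u(α), u(α - σ), u(α - 2σ) gives Tr u = - σ² u₂ in characteristic 3, so T₀ = F_q + F_q α.
-- For a product (x₀ + x₁ α)(y₀ + y₁ α) = b₀ + b₁ α + b₂ α² one has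
-- b₁² - b₀ b₂ = (x₀ y₁ - x₁ y₀)²; conversely a square root w ∈ F_q of b₁² - b₀ b₂ gives the
-- factorisation (w - b₁ + b₂ α)(α - (b₁ + w)/b₂).  Finally an element of F_q that is a
-- square in F_q(α) is a square in F_q: a square root v + u α + α² (after scaling) would make
-- u a root of X³ - X + a.

module Submission where

open import Defs
open import Level using (Level; 0ℓ; _⊔_)
open import Algebra.Bundles using (CommutativeRing; RawRing; AbelianGroup)
open import Algebra.Construct.DirectProduct using () renaming (abelianGroup to ×-abelianGroup)
open import Algebra.Solver.Ring.AlmostCommutativeRing
  using (fromCommutativeRing; _-Raw-AlmostCommutative⟶_)
open import Data.Fin as Fin using (Fin; zero; suc)
open import Data.Fin.Permutation using (Permutation; permutation)
open import Data.Fin.Properties using (punchInᵢ≢i)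
open import Data.List as List using ([]; _∷_; length)
open import Data.List.Properties using (length-tabulate)
open import Data.List.Relation.Unary.All as All using (All; _∷_)
import Data.List.Relation.Unary.All.Properties as AllP
open import Data.List.Relation.Unary.AllPairs using (AllPairs; _∷_)
import Data.List.Relation.Unary.AllPairs.Properties as AllPairsP
open import Data.Maybe using (Maybe; just; nothing)
open import Data.Nat as ℕ using (ℕ; zero; suc; _≤_; _∸_; z≤n; s≤s)
import Data.Nat.Properties as ℕ-Prop
open import Data.Product using (_×_; _,_; proj₁; proj₂; Σ-syntax; ∃-syntax)
import Data.Vec as Vec
open import Data.Vec.Functional using (removeAt)
open import Data.Vec.N-ary using (N-ary; _$ⁿ_; curryⁿ; Eq; Eqʰ; curryⁿ-cong; curryⁿ-cong⁻¹; Eqʰ-to-Eq)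
open import Function.Base using (_∘_)
open import Function.Bundles using (Inverse; Bijection; _⇔_; mk⇔)
import Function.Construct.Symmetry as Symmetry
open import Function.Properties.Bijection using (Bijection⇒Inverse)
open import Function.Properties.Inverse using (Inverse⇒Injection)
open import Relation.Binary.Definitions using (Decidable)
open import Relation.Binary.PropositionalEquality as ≡ using (_≡_; _≢_)
open import Relation.Nullary using (¬_)
open import Relation.Nullary.Decidable using (yes; no; via-injection)
open import Relation.Nullary.Negation using (contradiction)

-- Coefficients for the ring solver: normalising over 𝔽₃ lets it use 1 + 1 + 1 = 0.
data 𝔽₃ : Set where
  0₃ 1₃ 2₃ : 𝔽₃

infixl 6 _+₃_
infixl 7 _*₃_

-₃_ : 𝔽₃ → 𝔽₃
-₃ 0₃ = 0₃
-₃ 1₃ = 2₃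
-₃ 2₃ = 1₃

_+₃_ : 𝔽₃ → 𝔽₃ → 𝔽₃
0₃ +₃ y  = y
1₃ +₃ 0₃ = 1₃
1₃ +₃ 1₃ = 2₃
1₃ +₃ 2₃ = 0₃
2₃ +₃ 0₃ = 2₃
2₃ +₃ 1₃ = 0₃
2₃ +₃ 2₃ = 1₃

_*₃_ : 𝔽₃ → 𝔽₃ → 𝔽₃
0₃ *₃ y = 0₃
1₃ *₃ y = y
2₃ *₃ y = -₃ y

𝔽₃-rawRing : RawRing 0ℓ 0ℓ
𝔽₃-rawRing = record
  { Carrier = 𝔽₃ ; _≈_ = _≡_ ; _+_ = _+₃_ ; _*_ = _*₃_ ; -_ = -₃_ ; 0# = 0₃ ; 1# = 1₃ }

module Char3Solver {c ℓ} (R : CommutativeRing c ℓ) (char3 : Over.Char3 R) where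
  open CommutativeRing R
  open import Algebra.Properties.Ring ring using (-‿involutive; -0#≈0#; -‿+-comm; -1*x≈-x)
  open import Relation.Binary.Reasoning.Setoid setoid

  private
    ⟦_⟧₃ : 𝔽₃ → Carrier
    ⟦ 0₃ ⟧₃ = 0#
    ⟦ 1₃ ⟧₃ = 1#
    ⟦ 2₃ ⟧₃ = - 1#

    1+1≈-1 : 1# + 1# ≈ - 1#
    1+1≈-1 = begin
      1# + 1#                ≈⟨ +-identityʳ _ ⟨
      (1# + 1#) + 0#         ≈⟨ +-congˡ (-‿inverseʳ 1#) ⟨
      (1# + 1#) + (1# - 1#)  ≈⟨ +-assoc _ _ _ ⟨
      ((1# + 1#) + 1#) - 1#  ≈⟨ +-congʳ char3 ⟩
      0# - 1#                ≈⟨ +-identityˡ _ ⟩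
      - 1#                   ∎

    -1-1≈1 : - 1# + - 1# ≈ 1#
    -1-1≈1 = begin
      - 1# + - 1#  ≈⟨ -‿+-comm 1# 1# ⟩
      - (1# + 1#)  ≈⟨ -‿cong 1+1≈-1 ⟩
      - - 1#       ≈⟨ -‿involutive 1# ⟩
      1#           ∎

    -‿homo : ∀ x → ⟦ -₃ x ⟧₃ ≈ - ⟦ x ⟧₃
    -‿homo 0₃ = sym -0#≈0#
    -‿homo 1₃ = refl
    -‿homo 2₃ = sym (-‿involutive 1#)

    +-homo : ∀ x y → ⟦ x +₃ y ⟧₃ ≈ ⟦ x ⟧₃ + ⟦ y ⟧₃
    +-homo 0₃ y  = sym (+-identityˡ _)
    +-homo 1₃ 0₃ = sym (+-identityʳ _)
    +-homo 1₃ 1₃ = sym 1+1≈-1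
    +-homo 1₃ 2₃ = sym (-‿inverseʳ 1#)
    +-homo 2₃ 0₃ = sym (+-identityʳ _)
    +-homo 2₃ 1₃ = sym (-‿inverseˡ 1#)
    +-homo 2₃ 2₃ = sym -1-1≈1

    *-homo : ∀ x y → ⟦ x *₃ y ⟧₃ ≈ ⟦ x ⟧₃ * ⟦ y ⟧₃
    *-homo 0₃ y = sym (zeroˡ _)
    *-homo 1₃ y = sym (*-identityˡ _)
    *-homo 2₃ y = trans (-‿homo y) (sym (-1*x≈-x _))

    homomorphism : 𝔽₃-rawRing -Raw-AlmostCommutative⟶ fromCommutativeRing R
    homomorphism = record
      { ⟦_⟧ = ⟦_⟧₃ ; +-homo = +-homo ; *-homo = *-homo ; -‿homo = -‿homo
      ; 0-homo = refl ; 1-homo = refl }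

    _≟₃_ : ∀ x y → Maybe (⟦ x ⟧₃ ≈ ⟦ y ⟧₃)
    0₃ ≟₃ 0₃ = just refl
    1₃ ≟₃ 1₃ = just refl
    2₃ ≟₃ 2₃ = just refl
    _  ≟₃ _  = nothing

  open import Algebra.Solver.Ring 𝔽₃-rawRing (fromCommutativeRing R) homomorphism _≟₃_ public

module CommutativeRingFacts {c ℓ} (S : CommutativeRing c ℓ) where
  open CommutativeRing S hiding (zero)
  open import Algebra.Properties.Semiring.Exp semiring using (_^_)
  open import Algebra.Properties.Ring ring using (x[y-z]≈xy-xz)
  open import Algebra.Properties.CommutativeSemigroup +-commutativeSemigroup using (interchange)
  open import Algebra.Properties.CommutativeSemigroup *-commutativeSemigroup using (x∙yz≈y∙xz)
  open import Relation.Binary.Reasoning.Setoid setoid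

  NonZeroDivisor : Carrier → Set (c ⊔ ℓ)
  NonZeroDivisor x = ∀ {y} → x * y ≈ 0# → y ≈ 0#

  nonZeroDivisor-resp : ∀ {x x′} → x ≈ x′ → NonZeroDivisor x → NonZeroDivisor x′
  nonZeroDivisor-resp x≈x′ nzd x′y≈0 = nzd (trans (*-congʳ x≈x′) x′y≈0)

  nonZeroDivisor-*⁻¹ : ∀ {x w} → NonZeroDivisor (x * w) → NonZeroDivisor x
  nonZeroDivisor-*⁻¹ {x} {w} nzd {y} xy≈0 = nzd (begin
    x * w * y    ≈⟨ *-assoc x w y ⟩
    x * (w * y)  ≈⟨ x∙yz≈y∙xz x w y ⟩
    w * (x * y)  ≈⟨ *-congˡ xy≈0 ⟩
    w * 0#       ≈⟨ zeroʳ w ⟩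
    0#           ∎)

  -- f agrees with a polynomial of degree ≤ d whose coefficient of x^d is k; the
  -- polynomial is described through its divided differences rather than coefficients.
  IsPolyFun : ℕ → Carrier → (Carrier → Carrier) → Set (c ⊔ ℓ)
  IsPolyFun zero    k f = ∀ x → f x ≈ k
  IsPolyFun (suc d) k f = ∀ r → Σ[ g ∈ (Carrier → Carrier) ]
    IsPolyFun d k g × (∀ x → f x ≈ (x - r) * g x + f r)

  isPolyFun-coeff-cong : ∀ {d k k′ f} → k ≈ k′ → IsPolyFun d k f → IsPolyFun d k′ f
  isPolyFun-coeff-cong {zero}  k≈k′ f≈k x = trans (f≈k x) k≈k′
  isPolyFun-coeff-cong {suc d} k≈k′ pf r =
    let g , pg , f≈ = pf r in g , isPolyFun-coeff-cong k≈k′ pg , f≈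

  isPolyFun-raise : ∀ {d k f} → IsPolyFun d k f → IsPolyFun (suc d) 0# f
  isPolyFun-raise {zero} {k} {f} f≈k r = (λ _ → 0#) , (λ _ → refl) , λ x → begin
    f x                ≈⟨ f≈k x ⟩
    k                  ≈⟨ f≈k r ⟨
    f r                ≈⟨ +-identityˡ (f r) ⟨
    0# + f r           ≈⟨ +-congʳ (zeroʳ (x - r)) ⟨
    (x - r) * 0# + f r ∎
  isPolyFun-raise {suc d} pf r = let g , pg , f≈ = pf r in g , isPolyFun-raise pg , f≈

  isPolyFun-const : ∀ d {k} → IsPolyFun (suc d) 0# (λ _ → k)
  isPolyFun-const zero {k} = isPolyFun-raise {zero} {k} (λ _ → refl)
  isPolyFun-const (suc d) = isPolyFun-raise {suc d} (isPolyFun-const d)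

  isPolyFun-+ : ∀ {d k k′ f f′} → IsPolyFun d k f → IsPolyFun d k′ f′ →
                IsPolyFun d (k + k′) (λ x → f x + f′ x)
  isPolyFun-+ {zero}  f≈k f′≈k′ x = +-cong (f≈k x) (f′≈k′ x)
  isPolyFun-+ {suc d} {f = f} {f′} pf pf′ r =
    let g , pg , f≈ = pf r; g′ , pg′ , f′≈ = pf′ r
    in (λ x → g x + g′ x) , isPolyFun-+ pg pg′ , λ x → begin
      f x + f′ x                                          ≈⟨ +-cong (f≈ x) (f′≈ x) ⟩
      ((x - r) * g x + f r) + ((x - r) * g′ x + f′ r)    ≈⟨ interchange _ _ _ _ ⟩
      ((x - r) * g x + (x - r) * g′ x) + (f r + f′ r)    ≈⟨ +-congʳ (distribˡ (x - r) (g x) (g′ x)) ⟨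
      (x - r) * (g x + g′ x) + (f r + f′ r)              ∎

  isPolyFun-scale : ∀ s {d k f} → IsPolyFun d k f → IsPolyFun d (s * k) (λ x → s * f x)
  isPolyFun-scale s {zero}  f≈k x = *-congˡ (f≈k x)
  isPolyFun-scale s {suc d} {f = f} pf r =
    let g , pg , f≈ = pf r
    in (λ x → s * g x) , isPolyFun-scale s pg , λ x → begin
      s * f x                        ≈⟨ *-congˡ (f≈ x) ⟩
      s * ((x - r) * g x + f r)      ≈⟨ distribˡ s _ _ ⟩
      s * ((x - r) * g x) + s * f r  ≈⟨ +-congʳ (x∙yz≈y∙xz s (x - r) (g x)) ⟩
      (x - r) * (s * g x) + s * f r  ∎

  private
    split-* : ∀ r x y → x * y ≈ (x - r) * y + r * y
    split-* r x y = begin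
      x * y                    ≈⟨ *-congʳ (+-identityʳ x) ⟨
      (x + 0#) * y             ≈⟨ *-congʳ (+-congˡ (-‿inverseˡ r)) ⟨
      (x + (- r + r)) * y      ≈⟨ *-congʳ (+-assoc x (- r) r) ⟨
      ((x - r) + r) * y        ≈⟨ distribʳ y (x - r) r ⟩
      (x - r) * y + r * y      ∎

  isPolyFun-x* : ∀ {d k f} → IsPolyFun d k f → IsPolyFun (suc d) k (λ x → x * f x)
  isPolyFun-x* {zero} {f = f} f≈k r = f , f≈k , λ x → begin
    x * f x                  ≈⟨ split-* r x (f x) ⟩
    (x - r) * f x + r * f x  ≈⟨ +-congˡ (*-congˡ (trans (f≈k x) (sym (f≈k r)))) ⟩
    (x - r) * f x + r * f r  ∎
  isPolyFun-x* {suc d} {k} {f} pf r =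
    let g , pg , f≈ = pf r
    in (λ x → f x + r * g x) ,
       isPolyFun-coeff-cong {suc d} (+-identityʳ k)
         (isPolyFun-+ {suc d} pf (isPolyFun-raise {d} (isPolyFun-scale r pg))) ,
       λ x → begin
      x * f x                                       ≈⟨ split-* r x (f x) ⟩
      (x - r) * f x + r * f x                       ≈⟨ +-congˡ (*-congˡ (f≈ x)) ⟩
      (x - r) * f x + r * ((x - r) * g x + f r)     ≈⟨ +-congˡ (distribˡ r _ _) ⟩
      (x - r) * f x + (r * ((x - r) * g x) + r * f r)
                                                    ≈⟨ +-congˡ (+-congʳ (x∙yz≈y∙xz r (x - r) (g x))) ⟩
      (x - r) * f x + ((x - r) * (r * g x) + r * f r)
                                                    ≈⟨ +-assoc _ _ _ ⟨
      ((x - r) * f x + (x - r) * (r * g x)) + r * f r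
                                                    ≈⟨ +-congʳ (distribˡ (x - r) _ _) ⟨
      (x - r) * (f x + r * g x) + r * f r           ∎

  isPolyFun-^ : ∀ n → IsPolyFun n 1# (_^ n)
  isPolyFun-^ zero    x = refl
  isPolyFun-^ (suc n) = isPolyFun-x* (isPolyFun-^ n)

  roots-bound : ∀ {d k f} → IsPolyFun d k f → ¬ k ≈ 0# →
                ∀ {L} → AllPairs (λ u v → NonZeroDivisor (v - u)) L → All (λ u → f u ≈ 0#) L →
                length L ≤ d
  roots-bound                   _  _   {[]}    _             _             = z≤n
  roots-bound {zero}            f≈k k≉0 {u ∷ L} _             (fu≈0 ∷ _)  =
    contradiction (trans (sym (f≈k u)) fu≈0) k≉0
  roots-bound {suc d} {f = f} pf k≉0 {u ∷ L} (nzd ∷ dist) (fu≈0 ∷ roots) with pf u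
  ... | g , pg , f≈ = s≤s (roots-bound pg k≉0 dist (All.zipWith root-of-g (nzd , roots)))
    where
    root-of-g : ∀ {v} → NonZeroDivisor (v - u) × f v ≈ 0# → g v ≈ 0#
    root-of-g {v} (nzd , fv≈0) = nzd (begin
      (v - u) * g v        ≈⟨ +-identityʳ _ ⟨
      (v - u) * g v + 0#   ≈⟨ +-congˡ fu≈0 ⟨
      (v - u) * g v + f u  ≈⟨ f≈ v ⟨
      f v                  ≈⟨ fv≈0 ⟩
      0#                   ∎)

  fixedPoints-bound : ¬ 1# ≈ 0# → ∀ {n} → 2 ≤ n →
                      ∀ {L} → AllPairs (λ u v → NonZeroDivisor (v - u)) L → All (λ u → u ^ n ≈ u) L →
                      length L ≤ n
  fixedPoints-bound 1≉0 {suc zero}    (s≤s ())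
  fixedPoints-bound 1≉0 {suc (suc m)} _ dist fixed =
    roots-bound (isPolyFun-x* {suc m}
                  (isPolyFun-coeff-cong {suc m} (+-identityʳ 1#)
                    (isPolyFun-+ {suc m} (isPolyFun-^ (suc m)) (isPolyFun-const m))))
                1≉0 dist (All.map root fixed)
    where
    root : ∀ {u} → u ^ suc (suc m) ≈ u → u * (u ^ suc m - 1#) ≈ 0#
    root {u} u^n≈u = begin
      u * (u ^ suc m - 1#)         ≈⟨ x[y-z]≈xy-xz u _ _ ⟩
      u ^ suc (suc m) - u * 1#     ≈⟨ +-cong u^n≈u (-‿cong (*-identityʳ u)) ⟩
      u - u                        ≈⟨ -‿inverseʳ u ⟩
      0#                           ∎

module FieldFacts {c ℓ} (F : CommutativeRing c ℓ) (isField : IsField F) where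
  open CommutativeRing F
  open IsField isField
  open CommutativeRingFacts F using (NonZeroDivisor)
  open import Relation.Binary.Reasoning.Setoid setoid

  nonZero⇒nonZeroDivisor : ∀ {x} → ¬ x ≈ 0# → NonZeroDivisor x
  nonZero⇒nonZeroDivisor {x} x≉0 {y} xy≈0 = let x⁻¹ , xx⁻¹≈1 = inverse x x≉0 in begin
    y              ≈⟨ *-identityˡ y ⟨
    1# * y         ≈⟨ *-congʳ (trans (*-comm x⁻¹ x) xx⁻¹≈1) ⟨
    x⁻¹ * x * y    ≈⟨ *-assoc x⁻¹ x y ⟩
    x⁻¹ * (x * y)  ≈⟨ *-congˡ xy≈0 ⟩
    x⁻¹ * 0#       ≈⟨ zeroʳ x⁻¹ ⟩
    0#             ∎

  *-nonZero : ∀ {x y} → ¬ x ≈ 0# → ¬ y ≈ 0# → ¬ x * y ≈ 0#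
  *-nonZero x≉0 y≉0 xy≈0 = y≉0 (nonZero⇒nonZeroDivisor x≉0 xy≈0)

  *-cancelʳ-nonZero : ∀ {x y z} → ¬ z ≈ 0# → x * z ≈ y * z → x ≈ y
  *-cancelʳ-nonZero {x} {y} {z} z≉0 xz≈yz = x∙y⁻¹≈ε⇒x≈y x y (nonZero⇒nonZeroDivisor z≉0 (begin
    z * (x - y)       ≈⟨ x[y-z]≈xy-xz z x y ⟩
    z * x - z * y     ≈⟨ +-cong (*-comm z x) (-‿cong (*-comm z y)) ⟩
    x * z - y * z     ≈⟨ +-congʳ xz≈yz ⟩
    y * z - y * z     ≈⟨ -‿inverseʳ (y * z) ⟩
    0#                ∎))
    where open import Algebra.Properties.Ring ring using (x[y-z]≈xy-xz; x∙y⁻¹≈ε⇒x≈y)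

module FiniteField {c ℓ} (F : CommutativeRing c ℓ) (isField : IsField F) {q} (card : HasCardinality F q) where
  open CommutativeRing F hiding (zero)
  open IsField isField
  open FieldFacts F isField
  open import Algebra.Properties.Semiring.Exp semiring using (_^_; ^-congˡ)
  open import Algebra.Definitions _≈_ using (Congruent₁)
  import Algebra.Properties.CommutativeMonoid.Sum *-commutativeMonoid as Π
  open import Relation.Binary.Reasoning.Setoid setoid
  open Inverse (Bijection⇒Inverse card) using (to; from; from-cong; strictlyInverseˡ; strictlyInverseʳ)

  _≟_ : Decidable _≈_
  _≟_ = via-injection (Inverse⇒Injection (Symmetry.inverse (Bijection⇒Inverse card))) Fin._≟_

  ∏ : (Carrier → Carrier) → Carrier
  ∏ f = Π.sum (λ i → f (to i))

  ∏-cong : ∀ {f g} → (∀ x → f x ≈ g x) → ∏ f ≈ ∏ g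
  ∏-cong f≈g = Π.sum-cong-≋ (λ i → f≈g (to i))

  ∏-* : ∀ f g → ∏ (λ x → f x * g x) ≈ ∏ f * ∏ g
  ∏-* f g = Π.∑-distrib-+ {q} (f ∘ to) (g ∘ to)

  ∏-const : ∀ x → ∏ (λ _ → x) ≈ x ^ q
  ∏-const x = Π.sum-replicate q

  private
    from-≈ : ∀ {y i} → y ≈ to i → from y ≡ i
    from-≈ {i = i} y≈to-i = ≡.trans (from-cong y≈to-i) (strictlyInverseʳ i)

    cancel : ∀ {u v} → u * v ≈ 1# → ∀ y → u * (v * y) ≈ y
    cancel {u} {v} uv≈1 y = begin
      u * (v * y)  ≈⟨ *-assoc u v y ⟨
      u * v * y    ≈⟨ *-congʳ uv≈1 ⟩
      1# * y       ≈⟨ *-identityˡ y ⟩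
      y            ∎

    sum-nonZero : ∀ {n} (t : Fin n → Carrier) → (∀ i → ¬ t i ≈ 0#) → ¬ Π.sum t ≈ 0#
    sum-nonZero {zero}  t _   = one≉zero
    sum-nonZero {suc n} t t≉0 = *-nonZero (t≉0 zero) (sum-nonZero (t ∘ suc) (t≉0 ∘ suc))

    sum-single : ∀ {n} (t : Fin n → Carrier) i → (∀ j → j ≢ i → t j ≈ 1#) → Π.sum t ≈ t i
    sum-single {suc n} t i t≈1 = begin
      Π.sum t                      ≈⟨ Π.sum-remove {i = i} t ⟩
      t i * Π.sum (removeAt t i)   ≈⟨ *-congˡ (Π.sum-cong-≋ {n} (λ j → t≈1 _ (punchInᵢ≢i i j))) ⟩
      t i * Π.sum {n} (λ _ → 1#)   ≈⟨ *-congˡ (Π.sum-replicate-zero n) ⟩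
      t i * 1#                     ≈⟨ *-identityʳ (t i) ⟩
      t i                          ∎

  ∏-reindex : ∀ {x} → ¬ x ≈ 0# → ∀ {f} → Congruent₁ f → ∏ f ≈ ∏ (λ y → f (x * y))
  ∏-reindex {x} x≉0 {f} f-cong = begin
    Π.sum (f ∘ to)                          ≈⟨ Π.sum-permute (f ∘ to) π ⟩
    Π.sum (λ i → f (to (from (x * to i))))  ≈⟨ Π.sum-cong-≋ (λ i → f-cong (strictlyInverseˡ (x * to i))) ⟩
    Π.sum (λ i → f (x * to i))              ∎
    where
    x⁻¹ = proj₁ (inverse x x≉0)
    xx⁻¹≈1 = proj₂ (inverse x x≉0)
    x⁻¹x≈1 = trans (*-comm x⁻¹ x) xx⁻¹≈1
    π : Permutation q q
    π = permutation (λ i → from (x * to i)) (λ i → from (x⁻¹ * to i))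
      (λ i → from-≈ (trans (*-congˡ (strictlyInverseˡ _)) (cancel xx⁻¹≈1 (to i))))
      (λ i → from-≈ (trans (*-congˡ (strictlyInverseˡ _)) (cancel x⁻¹x≈1 (to i))))

  ∏-nonZero : ∀ {f} → (∀ x → ¬ f x ≈ 0#) → ¬ ∏ f ≈ 0#
  ∏-nonZero f≉0 = sum-nonZero _ (λ i → f≉0 (to i))

  nonzeroPart : Carrier → Carrier
  nonzeroPart y with y ≟ 0#
  ... | yes _ = 1#
  ... | no  _ = y

  atZero : Carrier → Carrier → Carrier
  atZero x y with y ≟ 0#
  ... | yes _ = x
  ... | no  _ = 1#

  nonzeroPart-cong : Congruent₁ nonzeroPart
  nonzeroPart-cong {y} {y′} y≈y′ with y ≟ 0# | y′ ≟ 0#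
  ... | yes _    | yes _     = refl
  ... | yes y≈0  | no y′≉0   = contradiction (trans (sym y≈y′) y≈0) y′≉0
  ... | no y≉0   | yes y′≈0  = contradiction (trans y≈y′ y′≈0) y≉0
  ... | no _     | no _      = y≈y′

  nonzeroPart-nonZero : ∀ y → ¬ nonzeroPart y ≈ 0#
  nonzeroPart-nonZero y with y ≟ 0#
  ... | yes _   = one≉zero
  ... | no y≉0  = y≉0

  atZero-nonZero : ∀ x y → ¬ y ≈ 0# → atZero x y ≈ 1#
  atZero-nonZero x y y≉0 with y ≟ 0#
  ... | yes y≈0 = contradiction y≈0 y≉0
  ... | no _    = refl

  atZero-zero : ∀ x {y} → y ≈ 0# → atZero x y ≈ x
  atZero-zero x {y} y≈0 with y ≟ 0#
  ... | yes _   = refl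
  ... | no y≉0  = contradiction y≈0 y≉0

  ∏-atZero : ∀ x → ∏ (atZero x) ≈ x
  ∏-atZero x = begin
    ∏ (atZero x)             ≈⟨ sum-single (atZero x ∘ to) (from 0#) at-nonzero ⟩
    atZero x (to (from 0#))  ≈⟨ atZero-zero x (strictlyInverseˡ 0#) ⟩
    x                        ∎
    where
    at-nonzero : ∀ j → j ≢ from 0# → atZero x (to j) ≈ 1#
    at-nonzero j j≢ = atZero-nonZero x (to j) (λ to-j≈0 → j≢ (≡.sym (from-≈ (sym to-j≈0))))

  *-nonzeroPart : ∀ {x} → ¬ x ≈ 0# → ∀ y → x * nonzeroPart y ≈ nonzeroPart (x * y) * atZero x y
  *-nonzeroPart {x} x≉0 y with y ≟ 0# | (x * y) ≟ 0#
  ... | yes _   | yes _     = *-comm x 1#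
  ... | yes y≈0 | no xy≉0   = contradiction (trans (*-congˡ y≈0) (zeroʳ x)) xy≉0
  ... | no y≉0  | yes xy≈0  = contradiction xy≈0 (*-nonZero x≉0 y≉0)
  ... | no _    | no _      = sym (*-identityʳ (x * y))

  -- With P the product of the nonzero elements, for x ≠ 0:
  -- x^q P = ∏ x·nonzeroPart(y) = ∏ nonzeroPart(xy) · ∏ atZero x y = P x.
  fermat : ∀ x → x ^ q ≈ x
  fermat x with x ≟ 0#
  ... | yes x≈0 = begin
    x ^ q    ≈⟨ ^-congˡ q x≈0 ⟩
    0# ^ q   ≈⟨ 0^q≈0 (from 0#) ⟩
    0#       ≈⟨ x≈0 ⟨
    x        ∎
    where
    0^q≈0 : ∀ {n} → Fin n → 0# ^ n ≈ 0#
    0^q≈0 {suc n} _ = zeroˡ (0# ^ n)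
  ... | no x≉0 = *-cancelʳ-nonZero (∏-nonZero nonzeroPart-nonZero) (begin
    x ^ q * P                                     ≈⟨ *-congʳ (∏-const x) ⟨
    ∏ (λ _ → x) * P                               ≈⟨ ∏-* (λ _ → x) nonzeroPart ⟨
    ∏ (λ y → x * nonzeroPart y)                   ≈⟨ ∏-cong (*-nonzeroPart x≉0) ⟩
    ∏ (λ y → nonzeroPart (x * y) * atZero x y)    ≈⟨ ∏-* (λ y → nonzeroPart (x * y)) (atZero x) ⟩
    ∏ (λ y → nonzeroPart (x * y)) * ∏ (atZero x)  ≈⟨ *-cong (∏-reindex x≉0 nonzeroPart-cong) (sym (∏-atZero x)) ⟨
    P * x                                         ≈⟨ *-comm P x ⟩
    x * P                                         ∎)
    where
    P = ∏ nonzeroPart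

module Extension {c ℓ} (R : CommutativeRing c ℓ) (char3 : Over.Char3 R) (a : CommutativeRing.Carrier R) where
  open CommutativeRing R hiding (zero)
  open Over.Ext R a
  open Char3Solver R char3
  open import Algebra.Properties.Semiring.Exp semiring using (_^_; ^-assocʳ; ^-congʳ)

  Expr : ℕ → Set
  Expr n = Polynomial n × Polynomial n × Polynomial n

  ⟦_⟧E ⟦_⟧E↓ : ∀ {n} → Expr n → Env n → E
  ⟦ p₀ , p₁ , p₂ ⟧E  ρ = ⟦ p₀ ⟧ ρ , ⟦ p₁ ⟧ ρ , ⟦ p₂ ⟧ ρ
  ⟦ p₀ , p₁ , p₂ ⟧E↓ ρ = ⟦ p₀ ⟧↓ ρ , ⟦ p₁ ⟧↓ ρ , ⟦ p₂ ⟧↓ ρ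

  -- Solves an identity in E coordinatewise; the syntax below mirrors ι, _+E_, _*E_
  -- and translate clause by clause, so that the identity proved is literally the
  -- one stated about E.
  solveE : ∀ n (f : N-ary n (Polynomial n) (Expr n × Expr n)) →
           let l , r = f $ⁿ Vec.map var (Vec.allFin n) in
           Eqʰ n _≈E_ (curryⁿ ⟦ l ⟧E↓) (curryⁿ ⟦ r ⟧E↓) →
           Eq  n _≈E_ (curryⁿ ⟦ l ⟧E)  (curryⁿ ⟦ r ⟧E)
  solveE n f hyp = curryⁿ-cong _≈E_ ⟦ l ⟧E ⟦ r ⟧E λ ρ →
    let h₀ , h₁ , h₂ = curryⁿ-cong⁻¹ _≈E_ ⟦ l ⟧E↓ ⟦ r ⟧E↓ (Eqʰ-to-Eq n _≈E_ hyp) ρ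
    in prove ρ (proj₁ l) (proj₁ r) h₀ , prove ρ (proj₁ (proj₂ l)) (proj₁ (proj₂ r)) h₁ ,
       prove ρ (proj₂ (proj₂ l)) (proj₂ (proj₂ r)) h₂
    where
    l r : Expr n
    l = proj₁ (f $ⁿ Vec.map var (Vec.allFin n))
    r = proj₂ (f $ⁿ Vec.map var (Vec.allFin n))

  module _ {n : ℕ} where
    infixl 6 _⊕_
    infix 4 _⊜_

    ιₑ : Polynomial n → Expr n
    ιₑ p = p , con 0₃ , con 0₃

    ⊝_ : Expr n → Expr n
    ⊝ (x₀ , x₁ , x₂) = :- x₀ , :- x₁ , :- x₂

    _⊕_ : Expr n → Expr n → Expr n
    (x₀ , x₁ , x₂) ⊕ (y₀ , y₁ , y₂) = x₀ :+ y₀ , x₁ :+ y₁ , x₂ :+ y₂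

    translateₑ : Polynomial n → Expr n → Expr n
    translateₑ s (u₀ , u₁ , u₂) = (u₀ :- s :* u₁) :+ (s :* s) :* u₂ , u₁ :+ s :* u₂ , u₂

    _⊜_ : Expr n → Expr n → Expr n × Expr n
    x ⊜ y = x , y

  module Syntax {n} (A : Polynomial n) where
    infixl 7 _⊛_

    _⊛_ : Expr n → Expr n → Expr n
    (x₀ , x₁ , x₂) ⊛ (y₀ , y₁ , y₂) =
      let c₀ = x₀ :* y₀
          c₁ = x₀ :* y₁ :+ x₁ :* y₀
          c₂ = (x₀ :* y₂ :+ x₁ :* y₁) :+ x₂ :* y₀
          c₃ = x₁ :* y₂ :+ x₂ :* y₁
          c₄ = x₂ :* y₂
      in c₀ :- A :* c₃ , (c₁ :+ c₃) :- A :* c₄ , c₂ :+ c₄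

  -E_ : E → E
  -E (x₀ , x₁ , x₂) = - x₀ , - x₁ , - x₂

  _-E_ : E → E → E
  x -E y = x +E (-E y)

  *E-cong : ∀ {x x′ y y′} → x ≈E x′ → y ≈E y′ → (x *E y) ≈E (x′ *E y′)
  *E-cong (x₀≈ , x₁≈ , x₂≈) (y₀≈ , y₁≈ , y₂≈) =
    let c₁≈ = +-cong (*-cong x₀≈ y₁≈) (*-cong x₁≈ y₀≈)
        c₂≈ = +-cong (+-cong (*-cong x₀≈ y₂≈) (*-cong x₁≈ y₁≈)) (*-cong x₂≈ y₀≈)
        c₃≈ = +-cong (*-cong x₁≈ y₂≈) (*-cong x₂≈ y₁≈)
        c₄≈ = *-cong x₂≈ y₂≈
    in +-cong (*-cong x₀≈ y₀≈) (-‿cong (*-congˡ c₃≈)) ,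
       +-cong (+-cong c₁≈ c₃≈) (-‿cong (*-congˡ c₄≈)) , +-cong c₂≈ c₄≈

  *E-assoc : ∀ x y z → ((x *E y) *E z) ≈E (x *E (y *E z))
  *E-assoc (x₀ , x₁ , x₂) (y₀ , y₁ , y₂) (z₀ , z₁ , z₂) =
    solveE 10 (λ a x₀ x₁ x₂ y₀ y₁ y₂ z₀ z₁ z₂ →
      let open Syntax a; x = x₀ , x₁ , x₂; y = y₀ , y₁ , y₂; z = z₀ , z₁ , z₂ in
      x ⊛ y ⊛ z ⊜ x ⊛ (y ⊛ z)) (refl , refl , refl) a x₀ x₁ x₂ y₀ y₁ y₂ z₀ z₁ z₂

  *E-comm : ∀ x y → (x *E y) ≈E (y *E x)
  *E-comm (x₀ , x₁ , x₂) (y₀ , y₁ , y₂) =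
    solveE 7 (λ a x₀ x₁ x₂ y₀ y₁ y₂ → let open Syntax a; x = x₀ , x₁ , x₂; y = y₀ , y₁ , y₂ in
      x ⊛ y ⊜ y ⊛ x) (refl , refl , refl) a x₀ x₁ x₂ y₀ y₁ y₂

  *E-identityˡ : ∀ x → (ι 1# *E x) ≈E x
  *E-identityˡ (x₀ , x₁ , x₂) =
    solveE 4 (λ a x₀ x₁ x₂ → let open Syntax a; x = x₀ , x₁ , x₂ in
      ιₑ (con 1₃) ⊛ x ⊜ x) (refl , refl , refl) a x₀ x₁ x₂

  *E-identityʳ : ∀ x → (x *E ι 1#) ≈E x
  *E-identityʳ (x₀ , x₁ , x₂) =
    solveE 4 (λ a x₀ x₁ x₂ → let open Syntax a; x = x₀ , x₁ , x₂ in
      x ⊛ ιₑ (con 1₃) ⊜ x) (refl , refl , refl) a x₀ x₁ x₂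

  *E-distribˡ : ∀ x y z → (x *E (y +E z)) ≈E ((x *E y) +E (x *E z))
  *E-distribˡ (x₀ , x₁ , x₂) (y₀ , y₁ , y₂) (z₀ , z₁ , z₂) =
    solveE 10 (λ a x₀ x₁ x₂ y₀ y₁ y₂ z₀ z₁ z₂ →
      let open Syntax a; x = x₀ , x₁ , x₂; y = y₀ , y₁ , y₂; z = z₀ , z₁ , z₂ in
      x ⊛ (y ⊕ z) ⊜ x ⊛ y ⊕ x ⊛ z) (refl , refl , refl) a x₀ x₁ x₂ y₀ y₁ y₂ z₀ z₁ z₂

  *E-distribʳ : ∀ x y z → ((y +E z) *E x) ≈E ((y *E x) +E (z *E x))
  *E-distribʳ (x₀ , x₁ , x₂) (y₀ , y₁ , y₂) (z₀ , z₁ , z₂) =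
    solveE 10 (λ a x₀ x₁ x₂ y₀ y₁ y₂ z₀ z₁ z₂ →
      let open Syntax a; x = x₀ , x₁ , x₂; y = y₀ , y₁ , y₂; z = z₀ , z₁ , z₂ in
      (y ⊕ z) ⊛ x ⊜ y ⊛ x ⊕ z ⊛ x) (refl , refl , refl) a x₀ x₁ x₂ y₀ y₁ y₂ z₀ z₁ z₂

  E-commutativeRing : CommutativeRing c ℓ
  E-commutativeRing = record
    { Carrier = E ; _≈_ = _≈E_ ; _+_ = _+E_ ; _*_ = _*E_ ; -_ = -E_ ; 0# = ι 0# ; 1# = ι 1#
    ; isCommutativeRing = record
      { isRing = record
        { +-isAbelianGroup = AbelianGroup.isAbelianGroup
            (×-abelianGroup +-abelianGroup (×-abelianGroup +-abelianGroup +-abelianGroup))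
        ; *-cong     = *E-cong
        ; *-assoc    = *E-assoc
        ; *-identity = *E-identityˡ , *E-identityʳ
        ; distrib    = *E-distribˡ , *E-distribʳ
        }
      ; *-comm = *E-comm
      }
    }

  private
    module 𝔼 where
      open CommutativeRing E-commutativeRing public
      open import Algebra.Properties.Semiring.Exp (CommutativeRing.semiring E-commutativeRing) public
        using (_^_; ^-congˡ; ^-assocʳ)

  ^E≈^ : ∀ n x → (x ^E n) ≈E (x 𝔼.^ n)
  ^E≈^ zero    x = 𝔼.refl
  ^E≈^ (suc n) x = *E-cong 𝔼.refl (^E≈^ n x)

  ^E-congˡ : ∀ n {x y} → x ≈E y → (x ^E n) ≈E (y ^E n)
  ^E-congˡ n {x} {y} x≈y = 𝔼.trans (^E≈^ n x) (𝔼.trans (𝔼.^-congˡ n x≈y) (𝔼.sym (^E≈^ n y)))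

  ^E-assocʳ : ∀ x m n → ((x ^E m) ^E n) ≈E (x ^E (m ℕ.* n))
  ^E-assocʳ x m n = begin
    (x ^E m) ^E n      ≈⟨ ^E≈^ n (x ^E m) ⟩
    (x ^E m) 𝔼.^ n     ≈⟨ 𝔼.^-congˡ n (^E≈^ m x) ⟩
    (x 𝔼.^ m) 𝔼.^ n    ≈⟨ 𝔼.^-assocʳ x m n ⟩
    x 𝔼.^ (m ℕ.* n)    ≈⟨ ^E≈^ (m ℕ.* n) x ⟨
    x ^E (m ℕ.* n)     ∎
    where open import Relation.Binary.Reasoning.Setoid 𝔼.setoid

  mapE : (Carrier → Carrier) → E → E
  mapE f (u₀ , u₁ , u₂) = f u₀ , f u₁ , f u₂

  -- u(α) ↦ u(α - s); char 3 turns the coefficient -2s of α into s.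
  translate : Carrier → E → E
  translate s (u₀ , u₁ , u₂) = (u₀ - s * u₁) + (s * s) * u₂ , u₁ + s * u₂ , u₂

  translate-cong : ∀ {s s′ u u′} → s ≈ s′ → u ≈E u′ → translate s u ≈E translate s′ u′
  translate-cong s≈s′ (u₀≈ , u₁≈ , u₂≈) =
    +-cong (+-cong u₀≈ (-‿cong (*-cong s≈s′ u₁≈))) (*-cong (*-cong s≈s′ s≈s′) u₂≈) ,
    +-cong u₁≈ (*-cong s≈s′ u₂≈) , u₂≈

  translate-zero : ∀ u → translate 0# u ≈E u
  translate-zero (u₀ , u₁ , u₂) =
    solveE 3 (λ u₀ u₁ u₂ → translateₑ (con 0₃) (u₀ , u₁ , u₂) ⊜ (u₀ , u₁ , u₂))
      (refl , refl , refl) u₀ u₁ u₂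

  translate-cube : ∀ s u → (translate s u ^E 3) ≈E translate (s ^ 3 + a) (mapE (_^ 3) u)
  translate-cube s (u₀ , u₁ , u₂) =
    solveE 5 (λ a s u₀ u₁ u₂ → let open Syntax a; t = translateₑ s (u₀ , u₁ , u₂) in
      t ⊛ (t ⊛ (t ⊛ ιₑ (con 1₃))) ⊜ translateₑ (s :^ 3 :+ a) (u₀ :^ 3 , u₁ :^ 3 , u₂ :^ 3))
      (refl , refl , refl) a s u₀ u₁ u₂

  sum-of-translates : ∀ s u →
    ((u +E translate s u) +E translate s (translate s u)) ≈E ι (- (s * s * proj₂ (proj₂ u)))
  sum-of-translates s (u₀ , u₁ , u₂) =
    solveE 4 (λ s u₀ u₁ u₂ → let u = u₀ , u₁ , u₂ in
      (u ⊕ translateₑ s u) ⊕ translateₑ s (translateₑ s u) ⊜ ιₑ (:- (s :* s :* u₂)))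
      (refl , refl , refl) s u₀ u₁ u₂

  -- α ^ (3 ^ k) = α - σ k
  σ : ℕ → Carrier
  σ zero    = 0#
  σ (suc k) = σ k ^ 3 + a

  frobenius-iterate : ∀ k y → (y ^E (3 ℕ.^ k)) ≈E translate (σ k) (mapE (_^ (3 ℕ.^ k)) y)
  frobenius-iterate zero (y₀ , y₁ , y₂) =
    solveE 4 (λ a y₀ y₁ y₂ → let open Syntax a in
      (y₀ , y₁ , y₂) ⊛ ιₑ (con 1₃) ⊜ translateₑ (con 0₃) (y₀ :^ 1 , y₁ :^ 1 , y₂ :^ 1))
      (refl , refl , refl) a y₀ y₁ y₂
  frobenius-iterate (suc k) y@(y₀ , y₁ , y₂) = begin
    y ^E (3 ℕ.^ suc k)                                 ≡⟨ ≡.cong (y ^E_) (ℕ-Prop.*-comm 3 (3 ℕ.^ k)) ⟩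
    y ^E (3 ℕ.^ k ℕ.* 3)                               ≈⟨ ^E-assocʳ y (3 ℕ.^ k) 3 ⟨
    (y ^E (3 ℕ.^ k)) ^E 3                              ≈⟨ ^E-congˡ 3 (frobenius-iterate k y) ⟩
    translate (σ k) (mapE (_^ 3 ℕ.^ k) y) ^E 3         ≈⟨ translate-cube (σ k) (mapE (_^ 3 ℕ.^ k) y) ⟩
    translate (σ (suc k)) (mapE (λ t → (t ^ 3 ℕ.^ k) ^ 3) y)
                                                     ≈⟨ translate-cong refl (^-3^ y₀ , ^-3^ y₁ , ^-3^ y₂) ⟩
    translate (σ (suc k)) (mapE (_^ 3 ℕ.^ suc k) y)    ∎
    where
    open import Relation.Binary.Reasoning.Setoid 𝔼.setoid
    ^-3^ : ∀ t → (t ^ 3 ℕ.^ k) ^ 3 ≈ t ^ 3 ℕ.^ suc k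
    ^-3^ t = trans (^-assocʳ t (3 ℕ.^ k) 3) (^-congʳ t (ℕ-Prop.*-comm (3 ℕ.^ k) 3))

  module Frobenius (h : ℕ) (fermat : ∀ t → t ^ (3 ℕ.^ h) ≈ t) where
    open import Relation.Binary.Reasoning.Setoid 𝔼.setoid

    frobenius : ∀ y → (y ^E (3 ℕ.^ h)) ≈E translate (σ h) y
    frobenius y@(y₀ , y₁ , y₂) =
      𝔼.trans (frobenius-iterate h y) (translate-cong refl (fermat y₀ , fermat y₁ , fermat y₂))

    trace : ∀ y → Tr (3 ℕ.^ h) y ≈E ι (- (σ h * σ h * proj₂ (proj₂ y)))
    trace y = begin
      (y +E (y ^E q)) +E (y ^E (q ℕ.^ 2))
        ≡⟨ ≡.cong (λ n → (y +E (y ^E q)) +E (y ^E (q ℕ.* n))) (ℕ-Prop.*-identityʳ q) ⟩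
      (y +E (y ^E q)) +E (y ^E (q ℕ.* q))
        ≈⟨ 𝔼.+-congˡ (^E-assocʳ y q q) ⟨
      (y +E (y ^E q)) +E ((y ^E q) ^E q)
        ≈⟨ 𝔼.+-cong (𝔼.+-congˡ (frobenius y)) (𝔼.trans (^E-congˡ q (frobenius y)) (frobenius _)) ⟩
      (y +E translate (σ h) y) +E translate (σ h) (translate (σ h) y)
        ≈⟨ sum-of-translates (σ h) y ⟩
      ι (- (σ h * σ h * proj₂ (proj₂ y)))
        ∎
      where q = 3 ℕ.^ h

  α : E
  α = 0# , 1# , 0#

  cubicAt : Carrier → Carrier
  cubicAt r = r * r * r - r + a

  ι-*E : ∀ t u → (ι t *E u) ≈E mapE (t *_) u
  ι-*E t (u₀ , u₁ , u₂) =
    solveE 5 (λ a t u₀ u₁ u₂ → let open Syntax a in ιₑ t ⊛ (u₀ , u₁ , u₂) ⊜ (t :* u₀ , t :* u₁ , t :* u₂))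
      (refl , refl , refl) a t u₀ u₁ u₂

  ι-difference : ∀ t t′ → (ι t′ -E ι t) ≈E ι (t′ - t)
  ι-difference t t′ = solveE 2 (λ t t′ → ιₑ t′ ⊕ ⊝ ιₑ t ⊜ ιₑ (t′ :- t)) (refl , refl , refl) t t′

  -- (t - α)(t² - 1 + t α + α²) = t³ - t - (α³ - α), and α³ - α = - a.
  ι-minus-α-factor : ∀ t → ((ι t -E α) *E (t * t - 1# , t , 1#)) ≈E ι (cubicAt t)
  ι-minus-α-factor t =
    solveE 2 (λ a t → let open Syntax a in
      (ιₑ t ⊕ ⊝ (con 0₃ , con 1₃ , con 0₃)) ⊛ (t :* t :- con 1₃ , t , con 1₃) ⊜ ιₑ (t :* t :* t :- t :+ a))
      (refl , refl , refl) a t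

  linear-*E-linear : ∀ x₀ x₁ y₀ y₁ →
    ((x₀ , x₁ , 0#) *E (y₀ , y₁ , 0#)) ≈E (x₀ * y₀ , x₀ * y₁ + x₁ * y₀ , x₁ * y₁)
  linear-*E-linear x₀ x₁ y₀ y₁ =
    solveE 5 (λ a x₀ x₁ y₀ y₁ → let open Syntax a in
      (x₀ , x₁ , con 0₃) ⊛ (y₀ , y₁ , con 0₃) ⊜ (x₀ :* y₀ , x₀ :* y₁ :+ x₁ :* y₀ , x₁ :* y₁))
      (refl , refl , refl) a x₀ x₁ y₀ y₁

  mapE-*-square : ∀ i z → (mapE (_* i) z *E mapE (_* i) z) ≈E mapE (_* (i * i)) (z *E z)
  mapE-*-square i (z₀ , z₁ , z₂) =
    solveE 5 (λ a i z₀ z₁ z₂ → let open Syntax a; z = z₀ , z₁ , z₂; zi = z₀ :* i , z₁ :* i , z₂ :* i in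
      zi ⊛ zi ⊜ (let (c₀ , c₁ , c₂) = z ⊛ z in c₀ :* (i :* i) , c₁ :* (i :* i) , c₂ :* (i :* i)))
      (refl , refl , refl) a i z₀ z₁ z₂

  -- If the square of v + u α + α² lies in R, then u is a root of X³ - X + a.
  cubicAt-monic-square : ∀ v u →
    let (_ , c₁ , c₂) = (v , u , 1#) *E (v , u , 1#) in cubicAt u ≈ u * c₂ - c₁
  cubicAt-monic-square v u =
    solve 3 (λ a v u → let open Syntax a; (_ , c₁ , c₂) = (v , u , con 1₃) ⊛ (v , u , con 1₃) in
      u :* u :* u :- u :+ a := u :* c₂ :- c₁) refl a v u

  discriminant-linear-*E : ∀ x₀ x₁ y₀ y₁ → (x₀ * y₁ - x₁ * y₀) * (x₀ * y₁ - x₁ * y₀)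
    ≈ (x₀ * y₁ + x₁ * y₀) * (x₀ * y₁ + x₁ * y₀) - (x₀ * y₀) * (x₁ * y₁)
  discriminant-linear-*E x₀ x₁ y₀ y₁ =
    solve 4 (λ x₀ x₁ y₀ y₁ → (x₀ :* y₁ :- x₁ :* y₀) :* (x₀ :* y₁ :- x₁ :* y₀)
      := (x₀ :* y₁ :+ x₁ :* y₀) :* (x₀ :* y₁ :+ x₁ :* y₀) :- (x₀ :* y₀) :* (x₁ :* y₁)) refl x₀ x₁ y₀ y₁

  factor-by-discriminant : ∀ {b₀ b₁ b₂ w i} → w * w ≈ b₁ * b₁ - b₀ * b₂ → b₂ * i ≈ 1# →
    ((w - b₁ , b₂ , 0#) *E (- ((b₁ + w) * i) , 1# , 0#)) ≈E (b₀ , b₁ , b₂)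
  factor-by-discriminant {b₀} {b₁} {b₂} {w} {i} w²≈ b₂i≈1 =
    𝔼.trans (linear-*E-linear (w - b₁) b₂ (- ((b₁ + w) * i)) 1#)
            (coefficient₀ , coefficient₁ , *-identityʳ b₂)
    where
    open import Relation.Binary.Reasoning.Setoid setoid
    coefficient₀ : (w - b₁) * - ((b₁ + w) * i) ≈ b₀
    coefficient₀ = begin
      (w - b₁) * - ((b₁ + w) * i)
        ≈⟨ solve 3 (λ w b₁ i → (w :- b₁) :* (:- ((b₁ :+ w) :* i)) := (b₁ :* b₁ :- w :* w) :* i) refl w b₁ i ⟩
      (b₁ * b₁ - w * w) * i
        ≈⟨ *-congʳ (+-congˡ (-‿cong w²≈)) ⟩
      (b₁ * b₁ - (b₁ * b₁ - b₀ * b₂)) * i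
        ≈⟨ solve 4 (λ b₀ b₁ b₂ i → (b₁ :* b₁ :- (b₁ :* b₁ :- b₀ :* b₂)) :* i := b₀ :* (b₂ :* i)) refl b₀ b₁ b₂ i ⟩
      b₀ * (b₂ * i)
        ≈⟨ *-congˡ b₂i≈1 ⟩
      b₀ * 1#
        ≈⟨ *-identityʳ b₀ ⟩
      b₀
        ∎
    coefficient₁ : (w - b₁) * 1# + b₂ * - ((b₁ + w) * i) ≈ b₁
    coefficient₁ = begin
      (w - b₁) * 1# + b₂ * - ((b₁ + w) * i)
        ≈⟨ solve 4 (λ w b₁ b₂ i → (w :- b₁) :* con 1₃ :+ b₂ :* (:- ((b₁ :+ w) :* i))
                                  := w :- b₁ :- (b₁ :+ w) :* (b₂ :* i)) refl w b₁ b₂ i ⟩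
      w - b₁ - (b₁ + w) * (b₂ * i)
        ≈⟨ +-congˡ (-‿cong (*-congˡ b₂i≈1)) ⟩
      w - b₁ - (b₁ + w) * 1#
        ≈⟨ solve 2 (λ w b₁ → w :- b₁ :- (b₁ :+ w) :* con 1₃ := b₁) refl w b₁ ⟩
      b₁
        ∎

  irreducible⇒noRoot : ¬ 1# ≈ 0# → Over.Irreducible R (Over.cubic R a) → ∀ r → ¬ cubicAt r ≈ 0#
  irreducible⇒noRoot 1≉0 (_ , irreducible) r root =
    irreducible (X-r , quotient , (1 , s≤s z≤n , 1≉0) , (2 , s≤s z≤n , 1≉0) , coefficients)
    where
    open Over R using (Poly; coeff; mulCoeff; sumUpTo; cubic)
    open import Relation.Binary.Reasoning.Setoid setoid

    X-r quotient : Poly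
    X-r      = - r ∷ 1# ∷ []
    quotient = r * r - 1# ∷ r ∷ 1# ∷ []

    sumUpTo-zero : ∀ n F → (∀ i → F i ≈ 0#) → sumUpTo n F ≈ 0#
    sumUpTo-zero zero    F F≈0 = F≈0 0
    sumUpTo-zero (suc n) F F≈0 = trans (+-cong (sumUpTo-zero n F F≈0) (F≈0 (suc n))) (+-identityʳ 0#)

    coefficients : ∀ n → coeff (cubic a) n ≈ mulCoeff X-r quotient n
    coefficients 0 = begin
      a                               ≈⟨ solve 2 (λ a r → a := :- r :* (r :* r :- con 1₃) :+ (r :* r :* r :- r :+ a))
                                               refl a r ⟩
      - r * (r * r - 1#) + cubicAt r  ≈⟨ +-congˡ root ⟩
      - r * (r * r - 1#) + 0#         ≈⟨ +-identityʳ _ ⟩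
      - r * (r * r - 1#)              ∎
    coefficients 1 = solve 1 (λ r → :- con 1₃ := :- r :* r :+ con 1₃ :* (r :* r :- con 1₃)) refl r
    coefficients 2 = solve 1 (λ r →
      con 0₃ := :- r :* con 1₃ :+ con 1₃ :* r :+ con 0₃ :* (r :* r :- con 1₃)) refl r
    coefficients 3 = solve 1 (λ r →
      con 1₃ := :- r :* con 0₃ :+ con 1₃ :* con 1₃ :+ con 0₃ :* r :+ con 0₃ :* (r :* r :- con 1₃)) refl r
    coefficients (suc (suc (suc (suc n)))) = sym (sumUpTo-zero (4 ℕ.+ n) _ term≈0)
      where
      term≈0 : ∀ i → coeff X-r i * coeff quotient (4 ℕ.+ n ∸ i) ≈ 0#
      term≈0 0               = zeroʳ _
      term≈0 1               = zeroʳ _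
      term≈0 (suc (suc i))   = zeroˡ _

module TraceZeroProducts {c ℓ} (h : ℕ) (1≤h : 1 ≤ h) (R : CommutativeRing c ℓ) (isField : IsField R)
  (char3 : Over.Char3 R) (card : HasCardinality R (3 ℕ.^ h)) (a : CommutativeRing.Carrier R)
  (irreducible : Over.Irreducible R (Over.cubic R a)) where
  open CommutativeRing R hiding (zero)
  open IsField isField
  open Over.Ext R a
  open Extension R char3 a
  open FieldFacts R isField
  open FiniteField R isField card using (_≟_; fermat)
  open Frobenius h fermat
  open Bijection card using (to; injective)
  open import Algebra.Properties.Ring ring using (-0#≈0#; -‿injective; x∙y⁻¹≈ε⇒x≈y)
  private
    module 𝔼 where
      open CommutativeRing E-commutativeRing public
      open CommutativeRingFacts E-commutativeRing public
      open import Algebra.Properties.Semiring.Exp (CommutativeRing.semiring E-commutativeRing) public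
        using (_^_)

  q = 3 ℕ.^ h

  noRoot : ∀ r → ¬ cubicAt r ≈ 0#
  noRoot = irreducible⇒noRoot one≉zero irreducible

  ι-nonZeroDivisor : ∀ {t} → ¬ t ≈ 0# → 𝔼.NonZeroDivisor (ι t)
  ι-nonZeroDivisor {t} t≉0 {y} ty≈0 =
    let ty₀≈0 , ty₁≈0 , ty₂≈0 = 𝔼.trans (𝔼.sym (ι-*E t y)) ty≈0
    in nzd ty₀≈0 , nzd ty₁≈0 , nzd ty₂≈0
    where nzd = nonZero⇒nonZeroDivisor t≉0

  -- Otherwise every element of E would satisfy y^q = y, but the q + 1 elements
  -- α and ι t (t ∈ R) are roots of X^q - X whose differences are non-zero-divisors.
  σ≉0 : ¬ σ h ≈ 0#
  σ≉0 σ≈0 = ℕ-Prop.1+n≰n (≡.subst (λ n → suc n ≤ q) (length-tabulate element) bound)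
    where
    element : Fin q → E
    element i = ι (to i)

    every-fixed : ∀ y → (y 𝔼.^ q) ≈E y
    every-fixed y = 𝔼.trans (𝔼.sym (^E≈^ q y))
      (𝔼.trans (frobenius y) (𝔼.trans (translate-cong σ≈0 𝔼.refl) (translate-zero y)))

    α-apart : ∀ t → 𝔼.NonZeroDivisor (ι t -E α)
    α-apart t = 𝔼.nonZeroDivisor-*⁻¹
      (𝔼.nonZeroDivisor-resp (𝔼.sym (ι-minus-α-factor t)) (ι-nonZeroDivisor (noRoot t)))

    elements-apart : ∀ {i j} → i ≢ j → 𝔼.NonZeroDivisor (element j -E element i)
    elements-apart {i} {j} i≢j = 𝔼.nonZeroDivisor-resp (𝔼.sym (ι-difference (to i) (to j)))
      (ι-nonZeroDivisor λ tj-ti≈0 → i≢j (≡.sym (injective (x∙y⁻¹≈ε⇒x≈y (to j) (to i) tj-ti≈0))))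

    bound : length (α ∷ List.tabulate element) ≤ q
    bound = 𝔼.fixedPoints-bound (λ 1≈0 → one≉zero (proj₁ 1≈0)) (ℕ-Prop.^-monoʳ-< 3 (s≤s (s≤s z≤n)) 1≤h)
      (AllP.tabulate⁺ (λ i → α-apart (to i)) ∷ AllPairsP.tabulate⁺ elements-apart)
      (All.universal every-fixed _)

  T₀⇒linear : ∀ {x} → T₀ q x → proj₂ (proj₂ x) ≈ 0#
  T₀⇒linear {x} Trx≈0 = nonZero⇒nonZeroDivisor (*-nonZero σ≉0 σ≉0)
    (-‿injective (trans (proj₁ (𝔼.trans (𝔼.sym (trace x)) Trx≈0)) (sym -0#≈0#)))

  linear⇒T₀ : ∀ {x} → proj₂ (proj₂ x) ≈ 0# → T₀ q x
  linear⇒T₀ {x} x₂≈0 =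
    𝔼.trans (trace x) (trans (-‿cong (trans (*-congˡ x₂≈0) (zeroʳ _))) -0#≈0# , refl , refl)

  square-root-in-R : ∀ {z d} → (z *E z) ≈E ι d → ∃[ w ] w * w ≈ d
  square-root-in-R {z@(z₀ , z₁ , z₂)} {d} z²≈d with z₂ ≟ 0#
  ... | yes z₂≈0 =
    z₀ , proj₁ (𝔼.trans (𝔼.sym (linear-*E-linear z₀ z₁ z₀ z₁)) (𝔼.trans (*E-cong z≈ z≈) z²≈d))
    where
    z≈ : (z₀ , z₁ , 0#) ≈E z
    z≈ = refl , refl , sym z₂≈0
  ... | no z₂≉0 = contradiction cubic≈0 (noRoot (z₁ * i))
    where
    i = proj₁ (inverse z₂ z₂≉0)
    u = z₁ * i
    v = z₀ * i
    monic : mapE (_* i) z ≈E (v , u , 1#)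
    monic = refl , refl , proj₂ (inverse z₂ z₂≉0)
    square : ((v , u , 1#) *E (v , u , 1#)) ≈E mapE (_* (i * i)) (ι d)
    square = 𝔼.trans (*E-cong (𝔼.sym monic) (𝔼.sym monic))
      (𝔼.trans (mapE-*-square i z) (let e₀ , e₁ , e₂ = z²≈d in *-congʳ e₀ , *-congʳ e₁ , *-congʳ e₂))
    cubic≈0 : cubicAt u ≈ 0#
    cubic≈0 = let _ , c₁≈ , c₂≈ = square in begin
      cubicAt u                                      ≈⟨ cubicAt-monic-square v u ⟩
      u * _ - _                                      ≈⟨ +-cong (*-congˡ c₂≈) (-‿cong c₁≈) ⟩
      u * (0# * (i * i)) - 0# * (i * i)              ≈⟨ +-cong (*-congˡ (zeroˡ _)) (-‿cong (zeroˡ _)) ⟩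
      u * 0# - 0#                                    ≈⟨ +-cong (zeroʳ u) -0#≈0# ⟩
      0# + 0#                                        ≈⟨ +-identityʳ 0# ⟩
      0#                                             ∎
      where open import Relation.Binary.Reasoning.Setoid setoid

  T₀T₀⇒discriminant-square : ∀ {b₀ b₁ b₂} → InT₀T₀ q (elt b₀ b₁ b₂) → IsSquareE (ι (b₁ * b₁ - b₀ * b₂))
  T₀T₀⇒discriminant-square {b₀} {b₁} {b₂} ((x₀ , x₁ , x₂) , (y₀ , y₁ , y₂) , x∈T₀ , y∈T₀ , xy≈β) =
    ι w , 𝔼.trans (ι-*E w (ι w)) (w²≈ , zeroʳ w , zeroʳ w)
    where
    w = x₀ * y₁ - x₁ * y₀
    β≈ : (x₀ * y₀ , x₀ * y₁ + x₁ * y₀ , x₁ * y₁) ≈E (b₀ , b₁ , b₂)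
    β≈ = 𝔼.trans (𝔼.sym (linear-*E-linear x₀ x₁ y₀ y₁))
      (𝔼.trans (*E-cong (refl , refl , sym (T₀⇒linear x∈T₀)) (refl , refl , sym (T₀⇒linear y∈T₀)))
               xy≈β)
    w²≈ : w * w ≈ b₁ * b₁ - b₀ * b₂
    w²≈ = let e₀ , e₁ , e₂ = β≈ in
      trans (discriminant-linear-*E x₀ x₁ y₀ y₁) (+-cong (*-cong e₁ e₁) (-‿cong (*-cong e₀ e₂)))

  discriminant-square⇒T₀T₀ : ∀ {b₀ b₁ b₂} → IsSquareE (ι (b₁ * b₁ - b₀ * b₂)) → InT₀T₀ q (elt b₀ b₁ b₂)
  discriminant-square⇒T₀T₀ {b₀} {b₁} {b₂} (_ , z²≈) with square-root-in-R z²≈ | b₂ ≟ 0#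
  ... | _ | yes b₂≈0 =
    (b₀ , b₁ , 0#) , ι 1# , linear⇒T₀ refl , linear⇒T₀ refl ,
    𝔼.trans (*E-identityʳ _) (refl , refl , sym b₂≈0)
  ... | w , w²≈ | no b₂≉0 = let i , b₂i≈1 = inverse b₂ b₂≉0 in
    (w - b₁ , b₂ , 0#) , (- ((b₁ + w) * i) , 1# , 0#) , linear⇒T₀ refl , linear⇒T₀ refl ,
    factor-by-discriminant w²≈ b₂i≈1

open import Data.Nat using (_^_)

proposition3p14 : {c ℓ : Level} (h : ℕ) → 1 ≤ h →
    (R : CommutativeRing c ℓ) → IsField R → Over.Char3 R → HasCardinality R (3 ^ h) →
    (a : CommutativeRing.Carrier R) → Over.Irreducible R (Over.cubic R a) →
    (b₀ b₁ b₂ : CommutativeRing.Carrier R) →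
    Over.Ext.InT₀T₀ R a (3 ^ h) (Over.Ext.elt R a b₀ b₁ b₂)
      ⇔ Over.Ext.IsSquareE R a (Over.Ext.ι R a (CommutativeRing._-_ R (CommutativeRing._*_ R b₁ b₁) (CommutativeRing._*_ R b₀ b₂)))
proposition3p14 h 1≤h R isField char3 card a irreducible b₀ b₁ b₂ =
  mk⇔ T₀T₀⇒discriminant-square discriminant-square⇒T₀T₀
  where open TraceZeroProducts h 1≤h R isField char3 card a irreducible
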